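{- For any positive integers $n$ and $k$ with $n \ge 2k$, $$\frac{(n-k)(n+1)}{n(n-2k+1)} \le \frac{JL_{n+1,k}}{JL_{n,k}}.$$
   Context: For integers $n \ge 1$ and $k \ge 0$, $JL_{n,k} = \sum_{i=k}^{\lfloor n/2 \rfloor} \frac{n}{n-i} \binom{n-i}{i} \binom{i}{k}$, where an empty sum equals $0$. -}

module Defs where

open import Data.Nat as ℕ using (ℕ; zero; suc; _∸_; ⌊_/2⌋)
open import Data.Nat.Combinatorics using (_C_)
open import Data.Integer using (+_)
open import Data.Rational using (ℚ; 0ℚ; _+_; _*_; _÷_; _/_; NonZero)
open import Data.Rational.Properties using (_≟_)
open import Relation.Nullary using (yes; no; ¬_)
open import Data.Rational using (≢-nonZero)

-- total division on ℚ: q ÷ 0 is set to 0 (only used where the denominator is nonzero)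
_÷₀_ : ℚ → ℚ → ℚ
p ÷₀ q with q ≟ 0ℚ
... | yes _ = 0ℚ
... | no q≢0 = _÷_ p q {{≢-nonZero q≢0}}

ℚ[_] : ℕ → ℚ
ℚ[ m ] = (+ m) / 1

-- Σ_{i = a}^{b} f i  (empty, = 0, when b < a)
sumFromTo : ℕ → ℕ → (ℕ → ℚ) → ℚ
sumFromTo a b f = go a (suc b ∸ a)
  where
  go : ℕ → ℕ → ℚ
  go i zero = 0ℚ
  go i (suc m) = f i + go (suc i) m

JL : ℕ → ℕ → ℚ
JL n k = sumFromTo k ⌊ n /2⌋
  (λ i → (ℚ[ n ] ÷₀ ℚ[ n ∸ i ]) * ℚ[ (n ∸ i) C i ] * ℚ[ i C k ])

{-# OPTIONS --safe #-}
-- Write t n i = n/(n−i) · C(n−i, i) · C(i, k) for the i-th summand of JL_{n,k}. Since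
-- C(m+1, i)(m+1−i) = (m+1) C(m, i), the summands of JL_{n+1,k} and JL_{n,k} with the same index
-- compare as t (n+1) i / t n i = (n+1)(n−i) / (n (n+1−2i)), and (n−i)/(n+1−2i) is nondecreasing
-- in i. So for k ≤ i ≤ ⌊n/2⌋ the ratio is at least its value at i = k, which is the left-hand side
-- r of the inequality. Summing gives r · JL_{n,k} ≤ JL_{n+1,k}, because the one summand of
-- JL_{n+1,k} without a partner (i = ⌊(n+1)/2⌋ for odd n) is nonnegative; and JL_{n,k} > 0, its
-- summand at i = k being positive.
module Submission where

open import Data.Empty using (⊥-elim)
open import Data.List using (_∷_; [])
open import Data.Nat as ℕ using (ℕ; zero; suc; _∸_; z≤n; s≤s; ⌊_/2⌋; _≤‴_; ≤‴-refl; ≤‴-step)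
import Data.Nat.Properties as ℕ
open import Data.Nat.Coprimality as Coprime using (1-coprimeTo)
open import Data.Nat.Combinatorics using (_C_; nCk≡nC[n∸k]; nCk+nC[k+1]≡[n+1]C[k+1]; nC1≡n)
open import Data.Nat.Tactic.RingSolver using (solve; solve-∀)
open import Data.Product using (_,_; _×_)
open import Data.Rational as ℚ
  using (ℚ; mkℚ; 0ℚ; 1ℚ; _/_; 1/_; *≤*; *<*; ≢-nonZero; positive; nonNegative)
open import Function using (_∘_)
open import Relation.Binary.PropositionalEquality
open import Relation.Nullary using (yes; no)

open import Defs

module _ where
  open import Data.Nat using (_+_; _*_; _≤_; _<_)

  m≤⌊n/2⌋⇒m+m≤n : ∀ {m n} → m ≤ ⌊ n /2⌋ → m + m ≤ n
  m≤⌊n/2⌋⇒m+m≤n {m} {n} m≤n/2 = subst (m + m ≤_) (ℕ.⌊n/2⌋+⌈n/2⌉≡n n)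
    (ℕ.+-mono-≤ m≤n/2 (ℕ.≤-trans m≤n/2 (ℕ.⌊n/2⌋≤⌈n/2⌉ n)))

  m+m≤n⇒m≤⌊n/2⌋ : ∀ {m n} → m + m ≤ n → m ≤ ⌊ n /2⌋
  m+m≤n⇒m≤⌊n/2⌋ {m} m+m≤n = subst (_≤ _) (sym (ℕ.n≡⌊n+n/2⌋ m)) (ℕ.⌊n/2⌋-mono m+m≤n)

  m+n≡o⇒o∸m≡n : ∀ m n {o} → m + n ≡ o → o ∸ m ≡ n
  m+n≡o⇒o∸m≡n m n refl = ℕ.m+n∸m≡n m n

  0<nCk : ∀ {n k} → k ≤ n → 0 < n C k
  0<nCk {n} {zero} _ = s≤s z≤n
  0<nCk {suc n} {suc k} (s≤s k≤n) =
    subst (0 <_) (nCk+nC[k+1]≡[n+1]C[k+1] n k) (ℕ.<-≤-trans (0<nCk k≤n) (ℕ.m≤m+n _ _))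

  [1+k]*[1+n]C[1+k]≡[1+n]*nCk : ∀ n k → suc k * (suc n C suc k) ≡ suc n * (n C k)
  [1+k]*[1+n]C[1+k]≡[1+n]*nCk n zero =
    trans (ℕ.*-identityˡ _) (trans (nC1≡n (suc n)) (sym (ℕ.*-identityʳ _)))
  [1+k]*[1+n]C[1+k]≡[1+n]*nCk zero (suc k) = ℕ.*-zeroʳ (suc (suc k))
  [1+k]*[1+n]C[1+k]≡[1+n]*nCk (suc n) (suc k) = begin
    suc (suc k) * (suc (suc n) C suc (suc k))    ≡⟨ cong (suc (suc k) *_) (pascal (suc n) (suc k)) ⟨
    suc (suc k) * (x + y)                        ≡⟨ distrib k x y ⟩
    x + (suc k * x + suc (suc k) * y)
      ≡⟨ cong₂ (λ u v → x + (u + v)) (induct n k) (induct n (suc k)) ⟩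
    x + (suc n * (n C k) + suc n * (n C suc k))  ≡⟨ cong (x +_) (ℕ.*-distribˡ-+ (suc n) (n C k) _) ⟨
    x + suc n * (n C k + n C suc k)              ≡⟨ cong (λ z → x + suc n * z) (pascal n k) ⟩
    x + suc n * x                                ∎
    where
    open ≡-Reasoning
    pascal = nCk+nC[k+1]≡[n+1]C[k+1]
    induct = [1+k]*[1+n]C[1+k]≡[1+n]*nCk
    x = suc n C suc k
    y = suc n C suc (suc k)
    distrib : ∀ k x y → suc (suc k) * (x + y) ≡ x + (suc k * x + suc (suc k) * y)
    distrib = solve-∀

  [m+n]Cm≡[m+n]Cn : ∀ m n → (m + n) C m ≡ (m + n) C n
  [m+n]Cm≡[m+n]Cn m n = trans (nCk≡nC[n∸k] (ℕ.m≤m+n m n)) (cong ((m + n) C_) (ℕ.m+n∸m≡n m n))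

  [1+i+e]Ci*[1+e]≡[1+i+e]*[i+e]Ci : ∀ i e → (suc (i + e) C i) * suc e ≡ suc (i + e) * ((i + e) C i)
  [1+i+e]Ci*[1+e]≡[1+i+e]*[i+e]Ci i e = begin
    (suc (i + e) C i) * suc e      ≡⟨ cong (λ n → (n C i) * suc e) (ℕ.+-suc i e) ⟨
    ((i + suc e) C i) * suc e      ≡⟨ cong (_* suc e) ([m+n]Cm≡[m+n]Cn i (suc e)) ⟩
    ((i + suc e) C suc e) * suc e  ≡⟨ cong (λ n → (n C suc e) * suc e) (ℕ.+-suc i e) ⟩
    (suc (i + e) C suc e) * suc e  ≡⟨ ℕ.*-comm _ (suc e) ⟩
    suc e * (suc (i + e) C suc e)  ≡⟨ [1+k]*[1+n]C[1+k]≡[1+n]*nCk (i + e) e ⟩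
    suc (i + e) * ((i + e) C e)    ≡⟨ cong (suc (i + e) *_) ([m+n]Cm≡[m+n]Cn i e) ⟨
    suc (i + e) * ((i + e) C i)    ∎
    where open ≡-Reasoning

  -- Below, k ≤ i and i + i ≤ n are parametrised as i = k + d and n = i + i + e, so n − i = i + e.

  parametrised-differences : ∀ k d e → let i = k + d ; n = i + i + e in
    n ∸ i ≡ i + e × suc n ∸ i ≡ suc (i + e) × n ∸ k ≡ d + (i + e) × n ∸ 2 * k ≡ d + d + e
  parametrised-differences k d e =
      m+n≡o⇒o∸m≡n (k + d) (k + d + e) (solve (k ∷ d ∷ e ∷ []))
    , m+n≡o⇒o∸m≡n (k + d) (suc (k + d + e)) (solve (k ∷ d ∷ e ∷ []))
    , m+n≡o⇒o∸m≡n k (d + (k + d + e)) (solve (k ∷ d ∷ e ∷ []))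
    , m+n≡o⇒o∸m≡n (2 * k) (d + d + e) (solve (k ∷ d ∷ e ∷ []))

  [n∸k]*[1+n∸2i]≤[n∸i]*[1+n∸2k] : ∀ k d e → let m = k + d + e in (d + m) * suc e ≤ m * suc (d + d + e)
  [n∸k]*[1+n∸2i]≤[n∸i]*[1+n∸2k] k zero e = ℕ.≤-refl
  [n∸k]*[1+n∸2i]≤[n∸i]*[1+n∸2k] k (suc d) e =
    ℕ.≤-trans (ℕ.m≤m+n _ _) (ℕ.≤-reflexive (excess k d e))
    where
    excess : ∀ k d e → let m = k + suc d + e in
      (suc d + m) * suc e + suc d * (k + k + d + suc d + e) ≡ m * suc (suc d + suc d + e)
    excess = solve-∀

  -- c, c′ and b stand for C(n − i, i), C(n + 1 − i, i) and C(i, k). Multiplying by e + 1 = n + 1 − 2i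
  -- turns c′ into c through the hypothesis, after which both sides are F times those of the
  -- previous lemma.
  JL-numerators-cross-≤-parametrised : ∀ k d e c c′ b → let m = k + d + e ; n = k + d + (k + d) + e in
    c′ * suc e ≡ suc m * c →
    (d + m) * suc n * (n * c * b) * suc m ≤ m * (n * suc (d + d + e) * (suc n * c′ * b))
  JL-numerators-cross-≤-parametrised k d e c c′ b c′[1+e]≡[1+m]c =
    let m = k + d + e ; n = k + d + (k + d) + e ; F = n * suc n * b * (suc m * c) in
    ℕ.*-cancelʳ-≤ _ _ (suc e) (begin
      (d + m) * suc n * (n * c * b) * suc m * suc e
        ≡⟨ solve (k ∷ d ∷ e ∷ c ∷ b ∷ []) ⟩
      (d + m) * suc e * F
        ≤⟨ ℕ.*-monoˡ-≤ F ([n∸k]*[1+n∸2i]≤[n∸i]*[1+n∸2k] k d e) ⟩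
      m * suc (d + d + e) * F
        ≡⟨ cong (λ x → m * suc (d + d + e) * (n * suc n * b * x)) c′[1+e]≡[1+m]c ⟨
      m * suc (d + d + e) * (n * suc n * b * (c′ * suc e))
        ≡⟨ solve (k ∷ d ∷ e ∷ c′ ∷ b ∷ []) ⟩
      m * (n * suc (d + d + e) * (suc n * c′ * b)) * suc e
        ∎)
    where open ℕ.≤-Reasoning

import Data.Integer as ℤ
import Data.Integer.Properties as ℤ
open import Data.Rational using (_+_; _*_; _≤_; _<_)
open import Data.Rational.Properties

ℚ[]≡mkℚ : ∀ a → ℚ[ a ] ≡ mkℚ (ℤ.+ a) 0 (Coprime.sym (1-coprimeTo a))
ℚ[]≡mkℚ a = ↥p/↧p≡p (mkℚ (ℤ.+ a) 0 _)

ℚ[]-* : ∀ a b → ℚ[ a ℕ.* b ] ≡ ℚ[ a ] * ℚ[ b ]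
ℚ[]-* a b = begin
  ℚ[ a ℕ.* b ]           ≡⟨ cong (_/ 1) (ℤ.pos-* a b) ⟩
  (ℤ.+ a ℤ.* ℤ.+ b) / 1  ≡⟨ cong₂ _*_ (ℚ[]≡mkℚ a) (ℚ[]≡mkℚ b) ⟨
  ℚ[ a ] * ℚ[ b ]        ∎
  where open ≡-Reasoning

ℚ[]-mono-≤ : ∀ {a b} → a ℕ.≤ b → ℚ[ a ] ≤ ℚ[ b ]
ℚ[]-mono-≤ {a} {b} a≤b rewrite ℚ[]≡mkℚ a | ℚ[]≡mkℚ b =
  *≤* (subst₂ ℤ._≤_ (sym (ℤ.*-identityʳ (ℤ.+ a))) (sym (ℤ.*-identityʳ (ℤ.+ b))) (ℤ.+≤+ a≤b))

ℚ[]-mono-< : ∀ {a b} → a ℕ.< b → ℚ[ a ] < ℚ[ b ]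
ℚ[]-mono-< {a} {b} a<b rewrite ℚ[]≡mkℚ a | ℚ[]≡mkℚ b =
  *<* (subst₂ ℤ._<_ (sym (ℤ.*-identityʳ (ℤ.+ a))) (sym (ℤ.*-identityʳ (ℤ.+ b))) (ℤ.+<+ a<b))

ℚ[]-nonNeg : ∀ a → 0ℚ ≤ ℚ[ a ]
ℚ[]-nonNeg a = ℚ[]-mono-≤ {0} {a} z≤n

÷₀-*-comm : ∀ x y z → (x ÷₀ y) * z ≡ (x * z) ÷₀ y
÷₀-*-comm x y z with y ≟ 0ℚ
... | yes _ = *-zeroˡ z
... | no y≢0 = begin
  x * (1/ y) * z    ≡⟨ *-assoc x _ z ⟩
  x * ((1/ y) * z)  ≡⟨ cong (x *_) (*-comm _ z) ⟩
  x * (z * (1/ y))  ≡⟨ *-assoc x z _ ⟨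
  x * z * (1/ y)    ∎
  where
  open ≡-Reasoning
  instance _ = ≢-nonZero y≢0

÷₀-*-cancel : ∀ x {y} → 0ℚ < y → (x ÷₀ y) * y ≡ x
÷₀-*-cancel x {y} 0<y with y ≟ 0ℚ
... | yes y≡0 = ⊥-elim (<⇒≢ 0<y (sym y≡0))
... | no y≢0 = begin
  x * (1/ y) * y    ≡⟨ *-assoc x _ y ⟩
  x * ((1/ y) * y)  ≡⟨ cong (x *_) (*-inverseˡ y) ⟩
  x * 1ℚ            ≡⟨ *-identityʳ x ⟩
  x                 ∎
  where
  open ≡-Reasoning
  instance _ = ≢-nonZero y≢0

÷₀-nonNeg : ∀ {x y} → 0ℚ ≤ x → 0ℚ < y → 0ℚ ≤ x ÷₀ y
÷₀-nonNeg {x} {y} 0≤x 0<y = *-cancelʳ-≤-pos y {{positive 0<y}}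
  (subst₂ _≤_ (sym (*-zeroˡ y)) (sym (÷₀-*-cancel x 0<y)) 0≤x)

÷₀-pos : ∀ {x y} → 0ℚ < x → 0ℚ < y → 0ℚ < x ÷₀ y
÷₀-pos {x} {y} 0<x 0<y = *-cancelʳ-<-nonNeg y {{nonNegative (<⇒≤ 0<y)}}
  (subst₂ _<_ (sym (*-zeroˡ y)) (sym (÷₀-*-cancel x 0<y)) 0<x)

÷₀-≤-÷₀ : ∀ {x y z w} → 0ℚ < y → 0ℚ < w → x * w ≤ y * z → x ÷₀ y ≤ z ÷₀ w
÷₀-≤-÷₀ {x} {y} {z} {w} 0<y 0<w xw≤yz =
  *-cancelʳ-≤-pos (y * w) {{pos*pos⇒pos y {{positive 0<y}} w {{positive 0<w}}}}
    (subst₂ _≤_ (sym lhs) (sym rhs) xw≤yz)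
  where
  open ≡-Reasoning
  lhs : (x ÷₀ y) * (y * w) ≡ x * w
  lhs = begin
    (x ÷₀ y) * (y * w)  ≡⟨ *-assoc (x ÷₀ y) y w ⟨
    (x ÷₀ y) * y * w    ≡⟨ cong (_* w) (÷₀-*-cancel x 0<y) ⟩
    x * w               ∎
  rhs : (z ÷₀ w) * (y * w) ≡ y * z
  rhs = begin
    (z ÷₀ w) * (y * w)  ≡⟨ cong ((z ÷₀ w) *_) (*-comm y w) ⟩
    (z ÷₀ w) * (w * y)  ≡⟨ *-assoc (z ÷₀ w) w y ⟨
    (z ÷₀ w) * w * y    ≡⟨ cong (_* y) (÷₀-*-cancel z 0<w) ⟩
    z * y               ≡⟨ *-comm z y ⟩
    y * z               ∎

fraction-*-ℚ[] : ∀ a y c → (ℚ[ a ] ÷₀ y) * ℚ[ c ] ≡ ℚ[ a ℕ.* c ] ÷₀ y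
fraction-*-ℚ[] a y c = trans (÷₀-*-comm ℚ[ a ] y ℚ[ c ]) (cong (_÷₀ y) (sym (ℚ[]-* a c)))

ℚ[]-*-fraction : ∀ p a y → ℚ[ p ] * (ℚ[ a ] ÷₀ y) ≡ ℚ[ p ℕ.* a ] ÷₀ y
ℚ[]-*-fraction p a y = begin
  ℚ[ p ] * (ℚ[ a ] ÷₀ y)  ≡⟨ *-comm ℚ[ p ] _ ⟩
  (ℚ[ a ] ÷₀ y) * ℚ[ p ]  ≡⟨ fraction-*-ℚ[] a y p ⟩
  ℚ[ a ℕ.* p ] ÷₀ y       ≡⟨ cong (λ m → ℚ[ m ] ÷₀ y) (ℕ.*-comm a p) ⟩
  ℚ[ p ℕ.* a ] ÷₀ y       ∎
  where open ≡-Reasoning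

fraction-nonNeg : ∀ a b → 0ℚ ≤ ℚ[ a ] ÷₀ ℚ[ b ]
fraction-nonNeg a zero    = ≤-refl
fraction-nonNeg a (suc b) = ÷₀-nonNeg (ℚ[]-nonNeg a) (ℚ[]-mono-< {0} {suc b} ℕ.z<s)

fraction-≤ : ∀ {a b c d} → 0 ℕ.< b → 0 ℕ.< d → a ℕ.* d ℕ.≤ b ℕ.* c →
  ℚ[ a ] ÷₀ ℚ[ b ] ≤ ℚ[ c ] ÷₀ ℚ[ d ]
fraction-≤ {a} {b} {c} {d} 0<b 0<d ad≤bc = ÷₀-≤-÷₀ (ℚ[]-mono-< 0<b) (ℚ[]-mono-< 0<d)
  (subst₂ _≤_ (ℚ[]-* a d) (ℚ[]-* b c) (ℚ[]-mono-≤ ad≤bc))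

sumFromTo-unfold : ∀ {a b} f → a ℕ.≤ b → sumFromTo a b f ≡ f a + sumFromTo (suc a) b f
sumFromTo-unfold f a≤b rewrite ℕ.+-∸-assoc 1 a≤b = refl

sumFromTo-empty : ∀ {a b} f → b ℕ.< a → sumFromTo a b f ≡ 0ℚ
sumFromTo-empty f b<a rewrite ℕ.m≤n⇒m∸n≡0 b<a = refl

downward-induction : ∀ {ℓ} (P : ℕ → Set ℓ) b →
  (∀ {a} → b ℕ.< a → P a) → (∀ {a} → a ℕ.≤ b → P (suc a) → P a) → ∀ a → P a
downward-induction P b above step a with a ℕ.≤? b
... | no a≰b = above (ℕ.≰⇒> a≰b)
... | yes a≤b = below (ℕ.≤⇒≤‴ a≤b)
  where
  below : ∀ {a} → a ≤‴ b → P a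
  below ≤‴-refl = step ℕ.≤-refl (above ℕ.≤-refl)
  below (≤‴-step 1+a≤‴b) = step (ℕ.<⇒≤ (ℕ.≤‴⇒≤ 1+a≤‴b)) (below 1+a≤‴b)

sumFromTo-*ˡ : ∀ r f a b → r * sumFromTo a b f ≡ sumFromTo a b ((r *_) ∘ f)
sumFromTo-*ˡ r f a b = downward-induction (λ a → r * sumFromTo a b f ≡ sumFromTo a b ((r *_) ∘ f)) b
  (λ {a} b<a → begin
    r * sumFromTo a b f         ≡⟨ cong (r *_) (sumFromTo-empty f b<a) ⟩
    r * 0ℚ                      ≡⟨ *-zeroʳ r ⟩
    0ℚ                          ≡⟨ sumFromTo-empty ((r *_) ∘ f) b<a ⟨
    sumFromTo a b ((r *_) ∘ f)  ∎)
  (λ {a} a≤b ih → begin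
    r * sumFromTo a b f                         ≡⟨ cong (r *_) (sumFromTo-unfold f a≤b) ⟩
    r * (f a + sumFromTo (suc a) b f)           ≡⟨ *-distribˡ-+ r (f a) _ ⟩
    r * f a + r * sumFromTo (suc a) b f         ≡⟨ cong (r * f a +_) ih ⟩
    r * f a + sumFromTo (suc a) b ((r *_) ∘ f)  ≡⟨ sumFromTo-unfold ((r *_) ∘ f) a≤b ⟨
    sumFromTo a b ((r *_) ∘ f)                  ∎)
  a
  where open ≡-Reasoning

sumFromTo-nonNeg : ∀ {f} a b → (∀ i → 0ℚ ≤ f i) → 0ℚ ≤ sumFromTo a b f
sumFromTo-nonNeg {f} a b f≥0 = downward-induction (λ a → 0ℚ ≤ sumFromTo a b f) b
  (λ b<a → ≤-reflexive (sym (sumFromTo-empty f b<a)))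
  (λ a≤b ih → subst (0ℚ ≤_) (sym (sumFromTo-unfold f a≤b)) (+-mono-≤ (f≥0 _) ih))
  a

sumFromTo-pos : ∀ {f a b} → a ℕ.≤ b → 0ℚ < f a → (∀ i → 0ℚ ≤ f i) → 0ℚ < sumFromTo a b f
sumFromTo-pos {f} {a} {b} a≤b 0<fa f≥0 =
  subst (0ℚ <_) (sym (sumFromTo-unfold f a≤b)) (+-mono-<-≤ 0<fa (sumFromTo-nonNeg (suc a) b f≥0))

sumFromTo-mono-≤ : ∀ {f g} a b → (∀ {i} → a ℕ.≤ i → i ℕ.≤ b → f i ≤ g i) →
  sumFromTo a b f ≤ sumFromTo a b g
sumFromTo-mono-≤ {f} {g} a b f≤g = downward-induction P b
  (λ b<a _ → ≤-reflexive (trans (sumFromTo-empty f b<a) (sym (sumFromTo-empty g b<a))))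
  (λ a≤b ih f≤g → subst₂ _≤_ (sym (sumFromTo-unfold f a≤b)) (sym (sumFromTo-unfold g a≤b))
    (+-mono-≤ (f≤g ℕ.≤-refl a≤b) (ih (λ a<i → f≤g (ℕ.<⇒≤ a<i)))))
  a f≤g
  where
  P : ℕ → Set
  P a = (∀ {i} → a ℕ.≤ i → i ℕ.≤ b → f i ≤ g i) → sumFromTo a b f ≤ sumFromTo a b g

sumFromTo-monoʳ-≤ : ∀ {f} a {b b′} → b ℕ.≤ b′ → (∀ i → 0ℚ ≤ f i) →
  sumFromTo a b f ≤ sumFromTo a b′ f
sumFromTo-monoʳ-≤ {f} a {b} {b′} b≤b′ f≥0 =
  downward-induction (λ a → sumFromTo a b f ≤ sumFromTo a b′ f) b
  (λ {a} b<a → subst (_≤ sumFromTo a b′ f) (sym (sumFromTo-empty f b<a)) (sumFromTo-nonNeg a b′ f≥0))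
  (λ a≤b ih → subst₂ _≤_ (sym (sumFromTo-unfold f a≤b))
                         (sym (sumFromTo-unfold f (ℕ.≤-trans a≤b b≤b′)))
    (+-monoʳ-≤ (f _) ih))
  a

-- JL n k is definitionally sumFromTo k ⌊ n /2⌋ (JL-term n k).
JL-term : ℕ → ℕ → ℕ → ℚ
JL-term n k i = (ℚ[ n ] ÷₀ ℚ[ n ∸ i ]) * ℚ[ (n ∸ i) C i ] * ℚ[ i C k ]

JL-numerator : ℕ → ℕ → ℕ → ℕ
JL-numerator n k i = n ℕ.* ((n ∸ i) C i) ℕ.* (i C k)

JL-term≡fraction : ∀ n k i → JL-term n k i ≡ ℚ[ JL-numerator n k i ] ÷₀ ℚ[ n ∸ i ]
JL-term≡fraction n k i = trans (cong (_* ℚ[ i C k ]) (fraction-*-ℚ[] n ℚ[ n ∸ i ] ((n ∸ i) C i)))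
  (fraction-*-ℚ[] (n ℕ.* ((n ∸ i) C i)) ℚ[ n ∸ i ] (i C k))

JL-term-nonNeg : ∀ n k i → 0ℚ ≤ JL-term n k i
JL-term-nonNeg n k i =
  subst (0ℚ ≤_) (sym (JL-term≡fraction n k i)) (fraction-nonNeg (JL-numerator n k i) (n ∸ i))

JL-numerators-cross-≤ : ∀ {n k i} → k ℕ.≤ i → i ℕ.+ i ℕ.≤ n →
  (n ∸ k) ℕ.* suc n ℕ.* JL-numerator n k i ℕ.* (suc n ∸ i)
    ℕ.≤ (n ∸ i) ℕ.* (n ℕ.* suc (n ∸ 2 ℕ.* k) ℕ.* JL-numerator (suc n) k i)
JL-numerators-cross-≤ {k = k} k≤i i+i≤n with ℕ.m≤n⇒∃[o]m+o≡n k≤i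
... | d , refl with ℕ.m≤n⇒∃[o]m+o≡n i+i≤n
... | e , refl with parametrised-differences k d e
... | n∸i , 1+n∸i , n∸k , n∸2k rewrite n∸i | 1+n∸i | n∸k | n∸2k =
  JL-numerators-cross-≤-parametrised k d e (m C i) (suc m C i) (i C k) ([1+i+e]Ci*[1+e]≡[1+i+e]*[i+e]Ci i e)
  where
  i = k ℕ.+ d
  m = i ℕ.+ e

JL-term-≤ : ∀ {n k i} → 1 ℕ.≤ k → k ℕ.≤ i → i ℕ.+ i ℕ.≤ n →
  ℚ[ (n ∸ k) ℕ.* suc n ] * JL-term n k i ≤ ℚ[ n ℕ.* suc (n ∸ 2 ℕ.* k) ] * JL-term (suc n) k i
JL-term-≤ {n} {k} {i} 1≤k k≤i i+i≤n = begin
  ℚ[ P ] * JL-term n k i                                ≡⟨ scaled-JL-term≡fraction P n ⟩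
  ℚ[ P ℕ.* JL-numerator n k i ] ÷₀ ℚ[ n ∸ i ]            ≤⟨ cross-≤ ⟩
  ℚ[ Q ℕ.* JL-numerator (suc n) k i ] ÷₀ ℚ[ suc n ∸ i ]  ≡⟨ scaled-JL-term≡fraction Q (suc n) ⟨
  ℚ[ Q ] * JL-term (suc n) k i                          ∎
  where
  open ≤-Reasoning
  P = (n ∸ k) ℕ.* suc n
  Q = n ℕ.* suc (n ∸ 2 ℕ.* k)
  scaled-JL-term≡fraction : ∀ p m →
    ℚ[ p ] * JL-term m k i ≡ ℚ[ p ℕ.* JL-numerator m k i ] ÷₀ ℚ[ m ∸ i ]
  scaled-JL-term≡fraction p m =
    trans (cong (ℚ[ p ] *_) (JL-term≡fraction m k i)) (ℚ[]-*-fraction p (JL-numerator m k i) ℚ[ m ∸ i ])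
  i<n : i ℕ.< n
  i<n = ℕ.<-≤-trans (ℕ.m<m+n i (ℕ.≤-trans 1≤k k≤i)) i+i≤n
  cross-≤ :
    ℚ[ P ℕ.* JL-numerator n k i ] ÷₀ ℚ[ n ∸ i ] ≤ ℚ[ Q ℕ.* JL-numerator (suc n) k i ] ÷₀ ℚ[ suc n ∸ i ]
  cross-≤ = fraction-≤ {P ℕ.* JL-numerator n k i} {n ∸ i} {Q ℕ.* JL-numerator (suc n) k i} {suc n ∸ i}
    (ℕ.m<n⇒0<n∸m i<n) (ℕ.m<n⇒0<n∸m (s≤s (ℕ.<⇒≤ i<n))) (JL-numerators-cross-≤ k≤i i+i≤n)

JL-pos : ∀ {n k} → 1 ℕ.≤ k → k ℕ.+ k ℕ.≤ n → 0ℚ < JL n k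
JL-pos {n} {k} 1≤k k+k≤n =
  sumFromTo-pos {JL-term n k} (m+m≤n⇒m≤⌊n/2⌋ {k} k+k≤n) first-term-pos (JL-term-nonNeg n k)
  where
  k<n : k ℕ.< n
  k<n = ℕ.<-≤-trans (ℕ.m<m+n k 1≤k) k+k≤n
  numerator-pos : 0 ℕ.< JL-numerator n k k
  numerator-pos = ℕ.*-mono-< (ℕ.*-mono-< (ℕ.≤-<-trans z≤n k<n) (0<nCk (ℕ.m+n≤o⇒m≤o∸n k k+k≤n)))
    (0<nCk {k} ℕ.≤-refl)
  first-term-pos : 0ℚ < JL-term n k k
  first-term-pos = subst (0ℚ <_) (sym (JL-term≡fraction n k k))
    (÷₀-pos (ℚ[]-mono-< numerator-pos) (ℚ[]-mono-< (ℕ.m<n⇒0<n∸m k<n)))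

JL-scaled-≤ : ∀ {n k} → 1 ℕ.≤ k →
  ℚ[ (n ∸ k) ℕ.* suc n ] * JL n k ≤ ℚ[ n ℕ.* suc (n ∸ 2 ℕ.* k) ] * JL (suc n) k
JL-scaled-≤ {n} {k} 1≤k = begin
  ℚ[ P ] * JL n k
    ≡⟨ sumFromTo-*ˡ ℚ[ P ] (JL-term n k) k ⌊ n /2⌋ ⟩
  sumFromTo k ⌊ n /2⌋ (λ i → ℚ[ P ] * JL-term n k i)
    ≤⟨ sumFromTo-mono-≤ k ⌊ n /2⌋ (λ k≤i i≤⌊n/2⌋ → JL-term-≤ 1≤k k≤i (m≤⌊n/2⌋⇒m+m≤n i≤⌊n/2⌋)) ⟩
  sumFromTo k ⌊ n /2⌋ (λ i → ℚ[ Q ] * JL-term (suc n) k i)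
    ≡⟨ sumFromTo-*ˡ ℚ[ Q ] (JL-term (suc n) k) k ⌊ n /2⌋ ⟨
  ℚ[ Q ] * sumFromTo k ⌊ n /2⌋ (JL-term (suc n) k)
    ≤⟨ *-monoˡ-≤-nonNeg ℚ[ Q ] {{nonNegative (ℚ[]-nonNeg Q)}}
         (sumFromTo-monoʳ-≤ k (ℕ.⌊n/2⌋-mono (ℕ.n≤1+n n)) (JL-term-nonNeg (suc n) k)) ⟩
  ℚ[ Q ] * JL (suc n) k
    ∎
  where
  open ≤-Reasoning
  P = (n ∸ k) ℕ.* suc n
  Q = n ℕ.* suc (n ∸ 2 ℕ.* k)

lemma2p2 : (n k : ℕ) → 1 ℕ.≤ k → 2 ℕ.* k ℕ.≤ n →
    ((ℚ[ n ∸ k ] * ℚ[ suc n ]) ÷₀ (ℚ[ n ] * ℚ[ suc (n ∸ 2 ℕ.* k) ]))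
      ≤ (JL (suc n) k ÷₀ JL n k)
lemma2p2 n k 1≤k 2k≤n = begin
  (ℚ[ n ∸ k ] * ℚ[ suc n ]) ÷₀ (ℚ[ n ] * ℚ[ suc (n ∸ 2 ℕ.* k) ])
    ≡⟨ cong₂ _÷₀_ (ℚ[]-* (n ∸ k) (suc n)) (ℚ[]-* n (suc (n ∸ 2 ℕ.* k))) ⟨
  ℚ[ (n ∸ k) ℕ.* suc n ] ÷₀ ℚ[ n ℕ.* suc (n ∸ 2 ℕ.* k) ]
    ≤⟨ ÷₀-≤-÷₀ (ℚ[]-mono-< (ℕ.*-mono-< 0<n ℕ.z<s)) (JL-pos 1≤k k+k≤n) (JL-scaled-≤ 1≤k) ⟩
  JL (suc n) k ÷₀ JL n k
    ∎
  where
  open ≤-Reasoning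
  k+k≤n : k ℕ.+ k ℕ.≤ n
  k+k≤n = subst (ℕ._≤ n) (cong (k ℕ.+_) (ℕ.+-identityʳ k)) 2k≤n
  0<n : 0 ℕ.< n
  0<n = ℕ.<-≤-trans (ℕ.<-≤-trans 1≤k (ℕ.m≤m+n k k)) k+k≤n
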